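{- Let $\Gamma$ be a graph and $v_0$ a vertex of $\Gamma$. Suppose $g\colon\mathbf P\to\mathbf{QD}_{v_0}(\Gamma)$ is an injective morphism of posets that preserves cover relations. Then there are parallel edges $e_1,e_2$ of $\Gamma$, with end-vertices $s,t$, and a subset $\mathcal E\subset E(\Gamma)\setminus\{e_1,e_2\}$ such that one of the following holds: (1) there is a divisor $D$ on $\Gamma^{\mathcal E}$ with $g(\mathbf P)=\{(\mathcal E\cup\{e_1\},D+v_{e_1}),(\mathcal E\cup\{e_2\},D+v_{e_2}),(\mathcal E,D+s),(\mathcal E,D+t)\}$; (2) there is a divisor $D$ on $\Gamma^{\mathcal E}$ with $g(\mathbf P)=\{(\mathcal E\cup\{e_1,e_2\},D-t+v_{e_1}+v_{e_2}),(\mathcal E\cup\{e_1,e_2\},D-s+v_{e_1}+v_{e_2}),(\mathcal E\cup\{e_1\},D+v_{e_1}),(\mathcal E\cup\{e_2\},D+v_{e_2})\}$.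
   Context: Graphs are finite, loops and multiple edges allowed, with weights $w\colon V(\Gamma)\to\mathbb Z_{\ge0}$ and genus $g_\Gamma=b_1(\Gamma)+\sum w(v)$; $\mathrm{val}(v)$ counts loops twice. Two edges are parallel if there are two vertices each incident to both. For $\mathcal E\subset E(\Gamma)$, $\Gamma^{\mathcal E}$ is obtained by inserting one vertex $v_e$ in the interior of each $e\in\mathcal E$. A pseudo-divisor is $(\mathcal E,D)$ with $D\colon V(\Gamma^{\mathcal E})\to\mathbb Z$, $D(v_e)=1$ for $e\in\mathcal E$. For a divisor $D$ on $\Gamma^{\mathcal E}$ and $e\notin\mathcal E$, $D+v_e$ denotes the divisor on $\Gamma^{\mathcal E\cup\{e\}}$ extending $D$ with value $1$ at $v_e$; $D\pm s$ adds $\pm1$ at vertex $s$. Order: $(\mathcal E,D)\ge(\mathcal E',D')$ iff $\mathcal E'\subset\mathcal E$ and there is $\varphi\colon\mathcal E\setminus\mathcal E'\to V(\Gamma)$, $\varphi(e)$ an end-vertex of $e$, with $D'(v)=D(v)+|\varphi^{ -1}(v)|$ for $v\in V(\Gamma)$. Canonical polarization $\mu(v)=w(v)-1+\mathrm{val}(v)/2$ on $V(\Gamma)$, $0$ on exceptional vertices; $(\mathcal E,D)$ of degree $g_\Gamma-1$ is $v_0$-quasistable if $D(V)-\mu(V)+\delta_V/2\ge0$ for all nonempty $V\subset V(\Gamma^{\mathcal E})$, strictly when $v_0\notin V$ ($\delta_V$ = number of edges of $\Gamma^{\mathcal E}$ between $V$ and its complement). $\mathbf{QD}_{v_0}(\Gamma)$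 is the poset of $v_0$-quasistable pseudo-divisors. $\mathbf P=\{\alpha,\beta,\gamma,\delta\}$ is the poset in which $\alpha>\gamma,\alpha>\delta,\beta>\gamma,\beta>\delta$ are the only strict relations. A morphism preserves cover relations if $f(x)$ covers $f(y)$ whenever $x$ covers $y$. -}

module Defs where

open import Data.Nat using (ℕ; zero; suc)
open import Data.Bool using (Bool; true; false; _∧_; _∨_; not; if_then_else_)
open import Data.Integer using (ℤ; +_; _+_; _-_; _*_; _≤_; _<_; 1ℤ; 0ℤ)
open import Data.Fin using (Fin; zero; suc; _≟_)
open import Data.Fin.Subset using (Subset; _∈_; _∉_; _⊆_; Nonempty; _∪_; ⁅_⁆)
open import Data.Vec using (Vec; lookup; updateAt)
open import Data.Product using (Σ; ∃; _×_; _,_)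
open import Data.Sum using (_⊎_)
open import Data.List using (List; _∷_; [])
open import Data.List.Membership.Propositional using () renaming (_∈_ to _∈ₗ_)
open import Relation.Nullary using (¬_; does)
open import Relation.Binary.PropositionalEquality using (_≡_; _≢_)

Σℤ : (k : ℕ) → (Fin k → ℤ) → ℤ
Σℤ zero    f = 0ℤ
Σℤ (suc k) f = f zero + Σℤ k (λ i → f (suc i))

ι : Bool → ℤ
ι true  = 1ℤ
ι false = 0ℤ

_xor_ : Bool → Bool → Bool
true  xor b = not b
false xor b = b

record Graph : Set where
  field
    n   : ℕ
    m   : ℕ
    src : Fin m → Fin n
    tgt : Fin m → Fin n
    w   : Fin n → ℕ
open Graph public

module _ (Γ : Graph) where

  IsEnd : Fin (m Γ) → Fin (n Γ) → Set
  IsEnd e v = v ≡ src Γ e ⊎ v ≡ tgt Γ e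

  data Reach : Fin (n Γ) → Fin (n Γ) → Set where
    here : ∀ {u} → Reach u u
    step : ∀ {u v} e → IsEnd e u → IsEnd e v → ∀ {x} → Reach v x → Reach u x

  Connected : Set
  Connected = ∀ u v → Reach u v

  -- val(v), loops counted twice
  val : Fin (n Γ) → ℤ
  val v = Σℤ (m Γ) (λ e → ι (does (src Γ e ≟ v)) + ι (does (tgt Γ e ≟ v)))

  -- genus g_Γ = b₁(Γ) + Σ w(v), with b₁ = |E| - |V| + 1 (Γ connected)
  genus : ℤ
  genus = (+ m Γ - + n Γ + 1ℤ) + Σℤ (n Γ) (λ v → + w Γ v)

  twoμ : Fin (n Γ) → ℤ
  twoμ v = + 2 * (+ w Γ v) - + 2 + val v

  Parallel : Fin (m Γ) → Fin (m Γ) → Fin (n Γ) → Fin (n Γ) → Set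
  Parallel e₁ e₂ s t =
    e₁ ≢ e₂ × s ≢ t × IsEnd e₁ s × IsEnd e₁ t × IsEnd e₂ s × IsEnd e₂ t

  -- Pseudo-divisors (ℰ , D).  The vertices of Γ^ℰ are V(Γ) together with
  -- one exceptional vertex v_e for every e ∈ ℰ; since D(v_e) = 1 is forced,
  -- D is recorded by its values on V(Γ).

  record PDiv : Set where
    constructor pd
    field
      ℰ : Subset (m Γ)
      D : Vec ℤ (n Γ)
  open PDiv public

  deg : PDiv → ℤ
  deg (pd ℰ D) = Σℤ (n Γ) (lookup D) + Σℤ (m Γ) (lookup (Data.Vec.map ι ℰ))

  -- A subset V of V(Γ^ℰ): A ⊆ V(Γ) and B ⊆ ℰ (exceptional vertices v_e, e ∈ B)
  -- 2 D(V)
  twoDV : PDiv → Subset (n Γ) → Subset (m Γ) → ℤ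
  twoDV (pd ℰ D) A B =
    + 2 * (Σℤ (n Γ) (λ v → ι (lookup A v) * lookup D v) + Σℤ (m Γ) (λ e → ι (lookup B e)))

  -- 2 μ(V)   (μ = 0 on exceptional vertices)
  twoμV : Subset (n Γ) → ℤ
  twoμV A = Σℤ (n Γ) (λ v → ι (lookup A v) * twoμ v)

  -- δ_V: edges of Γ^ℰ between V and its complement.  An edge e ∉ ℰ is an
  -- edge src e — tgt e; an edge e ∈ ℰ becomes two edges src e — v_e — tgt e.
  δ : Subset (m Γ) → Subset (n Γ) → Subset (m Γ) → ℤ
  δ ℰ A B = Σℤ (m Γ) (λ e →
    if lookup ℰ e
    then ι (lookup A (src Γ e) xor lookup B e) + ι (lookup A (tgt Γ e) xor lookup B e)
    else ι (lookup A (src Γ e) xor lookup A (tgt Γ e)))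

  -- v₀-quasistable pseudo-divisor of degree g_Γ - 1 (inequality multiplied by 2)
  QuasiStable : Fin (n Γ) → PDiv → Set
  QuasiStable v₀ x =
    deg x ≡ genus - 1ℤ ×
    (∀ (A : Subset (n Γ)) (B : Subset (m Γ)) → B ⊆ PDiv.ℰ x → (Nonempty A ⊎ Nonempty B) →
       (0ℤ ≤ twoDV x A B - twoμV A + δ (PDiv.ℰ x) A B) ×
       (v₀ ∉ A → 0ℤ < twoDV x A B - twoμV A + δ (PDiv.ℰ x) A B))

  _≽_ : PDiv → PDiv → Set
  pd ℰ D ≽ pd ℰ' D' =
    ℰ' ⊆ ℰ ×
    Σ (Fin (m Γ) → Fin (n Γ)) (λ φ →
      (∀ e → e ∈ ℰ → e ∉ ℰ' → IsEnd e (φ e)) ×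
      (∀ v → lookup D' v ≡ lookup D v +
          Σℤ (m Γ) (λ e → ι (lookup ℰ e ∧ not (lookup ℰ' e) ∧ does (φ e ≟ v)))))

  _≻_ : PDiv → PDiv → Set
  x ≻ y = x ≽ y × x ≢ y

  CoversQD : Fin (n Γ) → PDiv → PDiv → Set
  CoversQD v₀ x y = x ≻ y × ¬ (Σ PDiv λ z → QuasiStable v₀ z × x ≻ z × z ≻ y)

  addV : PDiv → Fin (m Γ) → PDiv     -- (ℰ , D) ↦ (ℰ ∪ {e} , D + v_e)
  addV (pd ℰ D) e = pd (ℰ ∪ ⁅ e ⁆) D

  plusAt : PDiv → Fin (n Γ) → PDiv
  plusAt (pd ℰ D) s = pd ℰ (updateAt D s (_+ 1ℤ))

  minusAt : PDiv → Fin (n Γ) → PDiv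
  minusAt (pd ℰ D) s = pd ℰ (updateAt D s (_- 1ℤ))

data P : Set where
  α β γ δP : P

data _<P_ : P → P → Set where
  γ<α : γ <P α
  δ<α : δP <P α
  γ<β : γ <P β
  δ<β : δP <P β

_≤P_ : P → P → Set
x ≤P y = x ≡ y ⊎ x <P y

CoversP : P → P → Set
CoversP x y = y <P x × ¬ (Σ P λ z → y <P z × z <P x)

ImageIs : {X : Set} → (P → X) → List X → Set
ImageIs {X} g L = (∀ p → g p ∈ₗ L) × (∀ y → y ∈ₗ L → Σ P λ p → g p ≡ y)

{-# OPTIONS --safe #-}
module Submission where

open import Defs
open import Data.Nat as ℕ using (ℕ)
open import Data.Bool using (true; false; _∧_; _∨_; not; if_then_else_)
open import Data.Bool.Properties using (∨-identityʳ)
open import Data.Integer as ℤ using (ℤ; _+_; _-_; _*_; _≤_; _<_; 1ℤ; 0ℤ)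
open import Data.Integer.Tactic.RingSolver using (solve-∀)
import Data.Integer.Properties as ℤ
open import Algebra.Bundles using (AbelianGroup)
open import Algebra.Properties.Group (AbelianGroup.group ℤ.+-0-abelianGroup) using (identityʳ-unique)
open import Data.Fin using (Fin; zero; suc; _≟_)
open import Data.Fin.Properties using (any?; suc-injective)
open import Data.Fin.Subset using (Subset; inside; outside; _∈_; _∉_; _⊆_; Nonempty; _∪_; ⁅_⁆)
open import Data.Fin.Subset.Properties
  using (_∈?_; ⊆-antisym; p⊆p∪q; q⊆p∪q; x∈p∪q⁻; x∈⁅x⁆; x∈⁅y⁆⇒x≡y; x≢y⇒x∉⁅y⁆; ∪-assoc; ∪-comm)
open import Data.Vec using (Vec; lookup; updateAt; map; _[_]≔_; tabulate)
open import Data.Vec.Properties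
  using ([]=⇒lookup; lookup⇒[]=; lookup∘updateAt; lookup∘updateAt′; lookup∘update; lookup∘update′;
         lookup-zipWith; lookup-map; tabulate∘lookup; tabulate-cong; updateAt-updateAt; updateAt-id-local)
open import Data.Product using (Σ; _×_; _,_; proj₁; proj₂)
open import Data.Sum using (_⊎_; inj₁; inj₂)
import Data.Sum as Sum
open import Data.Empty using (⊥; ⊥-elim)
open import Data.List using (List; []; _∷_)
import Data.List as List
open import Data.List.Relation.Unary.Any using (here; there)
open import Data.List.Relation.Binary.Pointwise using (Pointwise; []; _∷_)
open import Data.List.Membership.Propositional using () renaming (_∈_ to _∈ₗ_)
open import Data.List.Membership.Propositional.Properties using (∈-map⁺; ∈-map⁻)
open import Function using (_∘_)
open import Relation.Nullary using (does; yes; no; Dec)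
open import Relation.Nullary.Decidable using (_×-dec_; ¬?)
open import Relation.Binary.PropositionalEquality

-- A cover x ⋗ y in QD_{v₀}(Γ) is an elementary specialisation: y arises from x by moving a
-- single exceptional vertex v_e onto an end-vertex of e.  Otherwise, specialising just one of
-- the edges dropped from x to y yields a pseudo-divisor strictly between them, and it is again
-- v₀-quasistable because the specialisation (E ∪ {f}, D + v_f) ↦ (E, D + u) leaves the
-- quasistability inequality of every cut unchanged, after transporting the cut.  So the four
-- covers α ⋗ γ, α ⋗ δ, β ⋗ γ, β ⋗ δ are elementary, with edges e₁, e₂, e₃, e₄ and end-vertices
-- u₁, u₂, u₃, u₄; comparing the two descriptions of g(γ) and of g(δ) forces u₁ + u₄ = u₂ + u₃
-- as divisors.  If e₁ = e₂ one gets shape (1), otherwise e₁ = e₃, e₂ = e₄ and shape (2).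

module _ {k : ℕ} where

  lookup-ext : ∀ {A : Set} {xs ys : Vec A k} → (∀ i → lookup xs i ≡ lookup ys i) → xs ≡ ys
  lookup-ext {xs = xs} {ys} eq = begin
    xs                   ≡⟨ tabulate∘lookup xs ⟨
    tabulate (lookup xs) ≡⟨ tabulate-cong eq ⟩
    tabulate (lookup ys) ≡⟨ tabulate∘lookup ys ⟩
    ys                   ∎
    where open ≡-Reasoning

  ∉⇒lookup≡outside : ∀ {i} {p : Subset k} → i ∉ p → lookup p i ≡ outside
  ∉⇒lookup≡outside {i} {p} i∉p with lookup p i in eq
  ... | inside  = ⊥-elim (i∉p (lookup⇒[]= i p eq))
  ... | outside = refl

  lookup≡outside⇒∉ : ∀ {i} {p : Subset k} → lookup p i ≡ outside → i ∉ p
  lookup≡outside⇒∉ eq i∈p with trans (sym ([]=⇒lookup i∈p)) eq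
  ... | ()

  lookup-∪⁅⁆-self : ∀ (p : Subset k) e → lookup (p ∪ ⁅ e ⁆) e ≡ inside
  lookup-∪⁅⁆-self p e = []=⇒lookup (q⊆p∪q p ⁅ e ⁆ (x∈⁅x⁆ e))

  lookup-∪⁅⁆-other : ∀ (p : Subset k) {e j} → j ≢ e → lookup (p ∪ ⁅ e ⁆) j ≡ lookup p j
  lookup-∪⁅⁆-other p {e} {j} j≢e = begin
    lookup (p ∪ ⁅ e ⁆) j          ≡⟨ lookup-zipWith _∨_ j p ⁅ e ⁆ ⟩
    lookup p j ∨ lookup ⁅ e ⁆ j   ≡⟨ cong (lookup p j ∨_) (∉⇒lookup≡outside (x≢y⇒x∉⁅y⁆ j≢e)) ⟩
    lookup p j ∨ outside          ≡⟨ ∨-identityʳ _ ⟩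
    lookup p j                    ∎
    where open ≡-Reasoning

  ∈-∪⁅⁆⁻ : ∀ {p : Subset k} {e j} → j ∈ p ∪ ⁅ e ⁆ → j ∉ p → j ≡ e
  ∈-∪⁅⁆⁻ {p} {e} j∈ j∉p with x∈p∪q⁻ p ⁅ e ⁆ j∈
  ... | inj₁ j∈p = ⊥-elim (j∉p j∈p)
  ... | inj₂ j∈e = x∈⁅y⁆⇒x≡y e j∈e

  ∈-∪⁅⁆-self : ∀ (p : Subset k) e → e ∈ p ∪ ⁅ e ⁆
  ∈-∪⁅⁆-self p e = q⊆p∪q p ⁅ e ⁆ (x∈⁅x⁆ e)

  ∪⁅⁆-≢⇒∈ : ∀ {p q : Subset k} {e f} → e ≢ f → p ∪ ⁅ e ⁆ ≡ q ∪ ⁅ f ⁆ → e ∈ q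
  ∪⁅⁆-≢⇒∈ {p} {q} {e} {f} e≢f eq with x∈p∪q⁻ q ⁅ f ⁆ (subst (e ∈_) eq (∈-∪⁅⁆-self p e))
  ... | inj₁ e∈q = e∈q
  ... | inj₂ e∈f = ⊥-elim (e≢f (x∈⁅y⁆⇒x≡y f e∈f))

  ∪⁅⁆-∉⇒≡ : ∀ {p q : Subset k} {e f} → e ∉ q → p ∪ ⁅ e ⁆ ≡ q ∪ ⁅ f ⁆ → e ≡ f
  ∪⁅⁆-∉⇒≡ {p} {e = e} e∉q eq = ∈-∪⁅⁆⁻ (subst (e ∈_) eq (∈-∪⁅⁆-self p e)) e∉q

  ∪⁅⁆-cancel : ∀ {p q : Subset k} {e} → e ∉ p → e ∉ q → p ∪ ⁅ e ⁆ ≡ q ∪ ⁅ e ⁆ → p ≡ q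
  ∪⁅⁆-cancel {p} {q} {e} e∉p e∉q eq = ⊆-antisym (shrink e∉p eq) (shrink e∉q (sym eq))
    where
    shrink : ∀ {p q} → e ∉ p → p ∪ ⁅ e ⁆ ≡ q ∪ ⁅ e ⁆ → p ⊆ q
    shrink {p} {q} e∉p eq {j} j∈p with x∈p∪q⁻ q ⁅ e ⁆ (subst (j ∈_) eq (p⊆p∪q ⁅ e ⁆ j∈p))
    ... | inj₁ j∈q = j∈q
    ... | inj₂ j∈e = ⊥-elim (e∉p (subst (_∈ p) (x∈⁅y⁆⇒x≡y e j∈e) j∈p))

  ∪⁅⁆-swap : ∀ (p : Subset k) e f → (p ∪ ⁅ e ⁆) ∪ ⁅ f ⁆ ≡ (p ∪ ⁅ f ⁆) ∪ ⁅ e ⁆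
  ∪⁅⁆-swap p e f = begin
    (p ∪ ⁅ e ⁆) ∪ ⁅ f ⁆  ≡⟨ ∪-assoc p ⁅ e ⁆ ⁅ f ⁆ ⟩
    p ∪ (⁅ e ⁆ ∪ ⁅ f ⁆)  ≡⟨ cong (p ∪_) (∪-comm ⁅ e ⁆ ⁅ f ⁆) ⟩
    p ∪ (⁅ f ⁆ ∪ ⁅ e ⁆)  ≡⟨ ∪-assoc p ⁅ f ⁆ ⁅ e ⁆ ⟨
    (p ∪ ⁅ f ⁆) ∪ ⁅ e ⁆  ∎
    where open ≡-Reasoning

  ∉-[]≔outside : ∀ (p : Subset k) i → i ∉ p [ i ]≔ outside
  ∉-[]≔outside p i = lookup≡outside⇒∉ (lookup∘update i p outside)

  ∈-[]≔-other⁺ : ∀ {p : Subset k} {i j s} → j ≢ i → j ∈ p → j ∈ p [ i ]≔ s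
  ∈-[]≔-other⁺ {p} {i} {j} {s} j≢i j∈p =
    lookup⇒[]= j _ (trans (lookup∘update′ j≢i p s) ([]=⇒lookup j∈p))

  ∈-[]≔-other⁻ : ∀ {p : Subset k} {i j s} → j ≢ i → j ∈ p [ i ]≔ s → j ∈ p
  ∈-[]≔-other⁻ {p} {i} {j} {s} j≢i j∈ =
    lookup⇒[]= j p (trans (sym (lookup∘update′ j≢i p s)) ([]=⇒lookup j∈))

  ∈-[]≔outside⁻ : ∀ {p : Subset k} {i j} → j ∈ p [ i ]≔ outside → j ∈ p
  ∈-[]≔outside⁻ {p} {i} {j} j∈ with j ≟ i
  ... | yes refl = ⊥-elim (∉-[]≔outside p i j∈)
  ... | no j≢i   = ∈-[]≔-other⁻ j≢i j∈

  []≔outside-⊆ : ∀ {p q : Subset k} {i} → (∀ {j} → j ∈ p → j ∉ q → j ≡ i) → p [ i ]≔ outside ⊆ q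
  []≔outside-⊆ {p} {q} {i} only-i {j} j∈ with j ∈? q
  ... | yes j∈q = j∈q
  ... | no j∉q  = ⊥-elim (∉-[]≔outside p i (subst (_∈ p [ i ]≔ outside) (only-i (∈-[]≔outside⁻ j∈) j∉q) j∈))

  []≔outside-∪⁅⁆ : ∀ {p : Subset k} {i} → i ∈ p → (p [ i ]≔ outside) ∪ ⁅ i ⁆ ≡ p
  []≔outside-∪⁅⁆ {p} {i} i∈p = ⊆-antisym ⊆p p⊆
    where
    ⊆p : (p [ i ]≔ outside) ∪ ⁅ i ⁆ ⊆ p
    ⊆p {j} j∈ with x∈p∪q⁻ (p [ i ]≔ outside) ⁅ i ⁆ j∈
    ... | inj₁ j∈p-i = ∈-[]≔outside⁻ j∈p-i
    ... | inj₂ j∈i   = subst (_∈ p) (sym (x∈⁅y⁆⇒x≡y i j∈i)) i∈p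
    p⊆ : p ⊆ (p [ i ]≔ outside) ∪ ⁅ i ⁆
    p⊆ {j} j∈p with j ≟ i
    ... | yes refl = ∈-∪⁅⁆-self _ i
    ... | no j≢i   = p⊆p∪q ⁅ i ⁆ (∈-[]≔-other⁺ j≢i j∈p)

+1≢self : ∀ x → x + 1ℤ ≢ x
+1≢self x eq with identityʳ-unique x 1ℤ eq
... | ()

+2≢self : ∀ x → (x + 1ℤ) + 1ℤ ≢ x
+2≢self x eq with identityʳ-unique x (1ℤ + 1ℤ) (trans (sym (ℤ.+-assoc x 1ℤ 1ℤ)) eq)
... | ()

module _ {k : ℕ} where

  infixl 6 _⊕_ _⊖_

  _⊕_ : Vec ℤ k → Fin k → Vec ℤ k
  D ⊕ u = updateAt D u (_+ 1ℤ)

  _⊖_ : Vec ℤ k → Fin k → Vec ℤ k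
  D ⊖ u = updateAt D u (_- 1ℤ)

  lookup-⊕ : ∀ (D : Vec ℤ k) u v → lookup (D ⊕ u) v ≡ lookup D v + ι (does (u ≟ v))
  lookup-⊕ D u v with u ≟ v
  ... | yes refl = lookup∘updateAt u D
  ... | no u≢v   = trans (lookup∘updateAt′ v u (u≢v ∘ sym) D) (sym (ℤ.+-identityʳ _))

  ⊖-⊕ : ∀ (D : Vec ℤ k) u → (D ⊕ u) ⊖ u ≡ D
  ⊖-⊕ D u = trans (updateAt-updateAt u D) (updateAt-id-local u D (+1-1 (lookup D u)))
    where
    +1-1 : ∀ x → (x + 1ℤ) - 1ℤ ≡ x
    +1-1 = solve-∀

  ⊕-cancelʳ : ∀ {D D' : Vec ℤ k} {u} → D ⊕ u ≡ D' ⊕ u → D ≡ D'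
  ⊕-cancelʳ {D} {D'} {u} eq = begin
    D            ≡⟨ ⊖-⊕ D u ⟨
    (D ⊕ u) ⊖ u  ≡⟨ cong (_⊖ u) eq ⟩
    (D' ⊕ u) ⊖ u ≡⟨ ⊖-⊕ D' u ⟩
    D'           ∎
    where open ≡-Reasoning

  ⊕-cancelˡ : ∀ {D : Vec ℤ k} {a b} → D ⊕ a ≡ D ⊕ b → a ≡ b
  ⊕-cancelˡ {D} {a} {b} eq with a ≟ b
  ... | yes a≡b = a≡b
  ... | no a≢b  = ⊥-elim (+1≢self (lookup D a)
    (trans (sym (lookup∘updateAt a D)) (trans (cong (λ X → lookup X a) eq) (lookup∘updateAt′ a b a≢b D))))

  -- D' − D = a − b = c − d as divisors; if a ≠ b the left side is positive at a, forcing c = a.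
  ⊕-exchange : ∀ {D D' : Vec ℤ k} {a b c d} → D ⊕ a ≡ D' ⊕ b → D ⊕ c ≡ D' ⊕ d → a ≡ b ⊎ a ≡ c
  ⊕-exchange {D} {D'} {a} {b} {c} {d} eq₁ eq₂ with a ≟ b | a ≟ c
  ... | yes a≡b | _       = inj₁ a≡b
  ... | no _    | yes a≡c = inj₂ a≡c
  ... | no a≢b  | no a≢c  = ⊥-elim (at-d (d ≟ a))
    where
    at₁ : lookup D a + 1ℤ ≡ lookup D' a
    at₁ = trans (sym (lookup∘updateAt a D)) (trans (cong (λ X → lookup X a) eq₁) (lookup∘updateAt′ a b a≢b D'))
    at₂ : lookup D a ≡ lookup (D' ⊕ d) a
    at₂ = trans (sym (lookup∘updateAt′ a c a≢c D)) (cong (λ X → lookup X a) eq₂)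
    at-d : Dec (d ≡ a) → ⊥
    at-d (yes refl) = +2≢self (lookup D' a) (trans (cong (_+ 1ℤ) (trans (sym (lookup∘updateAt a D')) (sym at₂))) at₁)
    at-d (no d≢a)   = +1≢self (lookup D' a) (trans (cong (_+ 1ℤ) (sym (trans at₂ (lookup∘updateAt′ a d (d≢a ∘ sym) D')))) at₁)

Σℤ-cong : ∀ k {f g : Fin k → ℤ} → (∀ i → f i ≡ g i) → Σℤ k f ≡ Σℤ k g
Σℤ-cong ℕ.zero    eq = refl
Σℤ-cong (ℕ.suc k) eq = cong₂ _+_ (eq zero) (Σℤ-cong k (eq ∘ suc))

Σℤ-zero : ∀ k → Σℤ k (λ _ → 0ℤ) ≡ 0ℤ
Σℤ-zero ℕ.zero    = refl
Σℤ-zero (ℕ.suc k) = trans (ℤ.+-identityˡ _) (Σℤ-zero k)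

Σℤ-update : ∀ k {f g : Fin k → ℤ} (j : Fin k) {c} →
            (∀ i → i ≢ j → f i ≡ g i) → f j ≡ g j + c → Σℤ k f ≡ Σℤ k g + c
Σℤ-update (ℕ.suc k) {f} {g} zero {c} others at-j = begin
  f zero + Σℤ k (f ∘ suc)        ≡⟨ cong₂ _+_ at-j (Σℤ-cong k (λ i → others (suc i) λ ())) ⟩
  (g zero + c) + Σℤ k (g ∘ suc)  ≡⟨ swap (g zero) c (Σℤ k (g ∘ suc)) ⟩
  (g zero + Σℤ k (g ∘ suc)) + c  ∎
  where
  open ≡-Reasoning
  swap : ∀ x y z → (x + y) + z ≡ (x + z) + y
  swap = solve-∀
Σℤ-update (ℕ.suc k) {f} {g} (suc j) {c} others at-j = begin
  f zero + Σℤ k (f ∘ suc)        ≡⟨ cong₂ _+_ (others zero λ ()) (Σℤ-update k j (λ i i≢j → others (suc i) (i≢j ∘ suc-injective)) at-j) ⟩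
  g zero + (Σℤ k (g ∘ suc) + c)  ≡⟨ ℤ.+-assoc (g zero) _ c ⟨
  (g zero + Σℤ k (g ∘ suc)) + c  ∎
  where open ≡-Reasoning

module _ {k : ℕ} {D D' : Vec ℤ k} {a b c d : Fin k} (eq₁ : D ⊕ a ≡ D' ⊕ b) (eq₂ : D ⊕ c ≡ D' ⊕ d) where

  ⊕-square-rows : a ≢ c → a ≡ b × c ≡ d × D ≡ D'
  ⊕-square-rows a≢c with ⊕-exchange eq₁ eq₂
  ... | inj₂ a≡c  = ⊥-elim (a≢c a≡c)
  ... | inj₁ refl = refl , ⊕-cancelˡ (trans (cong (_⊕ c) (sym D≡D')) eq₂) , D≡D'
    where
    D≡D' : D ≡ D'
    D≡D' = ⊕-cancelʳ eq₁

  ⊕-square-columns : a ≢ b → a ≡ c × b ≡ d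
  ⊕-square-columns a≢b with ⊕-exchange eq₁ eq₂
  ... | inj₁ a≡b  = ⊥-elim (a≢b a≡b)
  ... | inj₂ refl = refl , ⊕-cancelˡ (trans (sym eq₁) eq₂)

∧-not-self : ∀ b c → b ∧ not b ∧ c ≡ false
∧-not-self true  c = refl
∧-not-self false c = refl

ι-xor-split : ∀ a b c → c ≡ a ⊎ c ≡ b → ι (a xor b) ≡ ι (a xor c) + ι (b xor c)
ι-xor-split true  true  _ (inj₁ refl) = refl
ι-xor-split true  false _ (inj₁ refl) = refl
ι-xor-split false true  _ (inj₁ refl) = refl
ι-xor-split false false _ (inj₁ refl) = refl
ι-xor-split true  true  _ (inj₂ refl) = refl
ι-xor-split true  false _ (inj₂ refl) = refl
ι-xor-split false true  _ (inj₂ refl) = refl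
ι-xor-split false false _ (inj₂ refl) = refl

module _ (Γ : Graph) where

  private
    N = n Γ
    M = m Γ

  crossings : Subset M → Subset N → Subset M → Fin M → ℤ
  crossings E A B e =
    if lookup E e
    then ι (lookup A (src Γ e) xor lookup B e) + ι (lookup A (tgt Γ e) xor lookup B e)
    else ι (lookup A (src Γ e) xor lookup A (tgt Γ e))

  margin : PDiv Γ → Subset N → Subset M → ℤ
  margin x A B = twoDV Γ x A B - twoμV Γ A + δ Γ (ℰ x) A B

  deg-specialise : ∀ {E D f} u → f ∉ E → deg Γ (pd E (D ⊕ u)) ≡ deg Γ (pd (E ∪ ⁅ f ⁆) D)
  deg-specialise {E} {D} {f} u f∉E = begin
    Σℤ N (lookup (D ⊕ u)) + Σℤ M (lookup (map ι E))
      ≡⟨ cong (_+ Σℤ M (lookup (map ι E))) (Σℤ-update N u (λ v v≢u → lookup∘updateAt′ v u v≢u D) (lookup∘updateAt u D)) ⟩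
    (Σℤ N (lookup D) + 1ℤ) + Σℤ M (lookup (map ι E))
      ≡⟨ swap (Σℤ N (lookup D)) (Σℤ M (lookup (map ι E))) ⟩
    Σℤ N (lookup D) + (Σℤ M (lookup (map ι E)) + 1ℤ)
      ≡⟨ cong (Σℤ N (lookup D) +_) (Σℤ-update M f edge-other edge-f) ⟨
    Σℤ N (lookup D) + Σℤ M (lookup (map ι (E ∪ ⁅ f ⁆)))  ∎
    where
    open ≡-Reasoning
    swap : ∀ x y → (x + 1ℤ) + y ≡ x + (y + 1ℤ)
    swap = solve-∀
    edge-other : ∀ e → e ≢ f → lookup (map ι (E ∪ ⁅ f ⁆)) e ≡ lookup (map ι E) e
    edge-other e e≢f = begin
      lookup (map ι (E ∪ ⁅ f ⁆)) e ≡⟨ lookup-map e ι (E ∪ ⁅ f ⁆) ⟩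
      ι (lookup (E ∪ ⁅ f ⁆) e)     ≡⟨ cong ι (lookup-∪⁅⁆-other E e≢f) ⟩
      ι (lookup E e)               ≡⟨ lookup-map e ι E ⟨
      lookup (map ι E) e           ∎
    edge-f : lookup (map ι (E ∪ ⁅ f ⁆)) f ≡ lookup (map ι E) f + 1ℤ
    edge-f = begin
      lookup (map ι (E ∪ ⁅ f ⁆)) f ≡⟨ lookup-map f ι (E ∪ ⁅ f ⁆) ⟩
      ι (lookup (E ∪ ⁅ f ⁆) f)     ≡⟨ cong ι (lookup-∪⁅⁆-self E f) ⟩
      ι outside + 1ℤ               ≡⟨ cong (λ s → ι s + 1ℤ) (∉⇒lookup≡outside f∉E) ⟨
      ι (lookup E f) + 1ℤ          ≡⟨ cong (_+ 1ℤ) (lookup-map f ι E) ⟨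
      lookup (map ι E) f + 1ℤ      ∎

  twoDV-specialise : ∀ {E D f u} (A : Subset N) {B : Subset M} → lookup B f ≡ outside →
    twoDV Γ (pd E (D ⊕ u)) A B ≡ twoDV Γ (pd (E ∪ ⁅ f ⁆) D) A (B [ f ]≔ lookup A u)
  twoDV-specialise {E} {D} {f} {u} A {B} Bf≡outside = cong (ℤ.+ 2 *_) (begin
    Σ[A·D⊕u] + Σ[B]        ≡⟨ cong (_+ Σ[B]) (Σℤ-update N u vertex-other vertex-u) ⟩
    (Σ[A·D] + Au) + Σ[B]   ≡⟨ swap Σ[A·D] Au Σ[B] ⟩
    Σ[A·D] + (Σ[B] + Au)   ≡⟨ cong (Σ[A·D] +_) (Σℤ-update M f edge-other edge-f) ⟨
    Σ[A·D] + Σ[B′]         ∎)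
    where
    open ≡-Reasoning
    Au Σ[A·D⊕u] Σ[A·D] Σ[B] Σ[B′] : ℤ
    B′ : Subset M
    Au       = ι (lookup A u)
    B′       = B [ f ]≔ lookup A u
    Σ[A·D⊕u] = Σℤ N (λ v → ι (lookup A v) * lookup (D ⊕ u) v)
    Σ[A·D]   = Σℤ N (λ v → ι (lookup A v) * lookup D v)
    Σ[B]     = Σℤ M (λ e → ι (lookup B e))
    Σ[B′]    = Σℤ M (λ e → ι (lookup B′ e))
    swap : ∀ x y z → (x + y) + z ≡ x + (z + y)
    swap = solve-∀
    distrib : ∀ x y → x * (y + 1ℤ) ≡ x * y + x
    distrib = solve-∀
    vertex-other : ∀ v → v ≢ u → ι (lookup A v) * lookup (D ⊕ u) v ≡ ι (lookup A v) * lookup D v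
    vertex-other v v≢u = cong (ι (lookup A v) *_) (lookup∘updateAt′ v u v≢u D)
    vertex-u : ι (lookup A u) * lookup (D ⊕ u) u ≡ ι (lookup A u) * lookup D u + Au
    vertex-u = trans (cong (Au *_) (lookup∘updateAt u D)) (distrib Au (lookup D u))
    edge-other : ∀ e → e ≢ f → ι (lookup B′ e) ≡ ι (lookup B e)
    edge-other e e≢f = cong ι (lookup∘update′ e≢f B (lookup A u))
    edge-f : ι (lookup B′ f) ≡ ι (lookup B f) + Au
    edge-f = begin
      ι (lookup B′ f)      ≡⟨ cong ι (lookup∘update f B (lookup A u)) ⟩
      Au                   ≡⟨ ℤ.+-identityˡ Au ⟨
      ι outside + Au       ≡⟨ cong (λ s → ι s + Au) Bf≡outside ⟨
      ι (lookup B f) + Au  ∎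

  -- Subdividing f and putting v_f on the side of u does not change the cut, since u is an end of f.
  δ-specialise : ∀ {E f u} → f ∉ E → IsEnd Γ f u → (A : Subset N) (B : Subset M) →
    δ Γ E A B ≡ δ Γ (E ∪ ⁅ f ⁆) A (B [ f ]≔ lookup A u)
  δ-specialise {E} {f} {u} f∉E f-u A B = Σℤ-cong M same-crossings
    where
    same-crossings : ∀ e → crossings E A B e ≡ crossings (E ∪ ⁅ f ⁆) A (B [ f ]≔ lookup A u) e
    same-crossings e with e ≟ f
    ... | yes refl
      rewrite ∉⇒lookup≡outside f∉E | lookup-∪⁅⁆-self E f | lookup∘update f B (lookup A u)
      = ι-xor-split _ _ _ (Sum.map (cong (lookup A)) (cong (lookup A)) f-u)
    ... | no e≢f
      rewrite lookup-∪⁅⁆-other E e≢f | lookup∘update′ e≢f B (lookup A u)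
      = refl

  quasiStable-specialise : ∀ {v₀ z f u} → f ∉ ℰ z → IsEnd Γ f u →
    QuasiStable Γ v₀ (addV Γ z f) → QuasiStable Γ v₀ (plusAt Γ z u)
  quasiStable-specialise {v₀} {pd E D} {f} {u} f∉E f-u (deg≡ , stable) =
    trans (deg-specialise {E} {D} {f} u f∉E) deg≡ , stable′
    where
    stable′ : ∀ A B → B ⊆ E → Nonempty A ⊎ Nonempty B →
      (0ℤ ≤ margin (pd E (D ⊕ u)) A B) × (v₀ ∉ A → 0ℤ < margin (pd E (D ⊕ u)) A B)
    stable′ A B B⊆E nonempty =
      subst (0ℤ ≤_) (sym same-margin) (proj₁ stable-B′) ,
      subst (0ℤ <_) (sym same-margin) ∘ proj₂ stable-B′
      where
      B′ : Subset M
      B′ = B [ f ]≔ lookup A u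
      f∉B : f ∉ B
      f∉B = f∉E ∘ B⊆E
      B′⊆ : B′ ⊆ E ∪ ⁅ f ⁆
      B′⊆ {e} e∈B′ with e ≟ f
      ... | yes refl = ∈-∪⁅⁆-self E f
      ... | no e≢f   = p⊆p∪q ⁅ f ⁆ (B⊆E (∈-[]≔-other⁻ e≢f e∈B′))
      nonempty′ : Nonempty A ⊎ Nonempty B′
      nonempty′ = Sum.map₂ (λ { (e , e∈B) → e , ∈-[]≔-other⁺ (λ { refl → f∉B e∈B }) e∈B }) nonempty
      stable-B′ : (0ℤ ≤ margin (pd (E ∪ ⁅ f ⁆) D) A B′) × (v₀ ∉ A → 0ℤ < margin (pd (E ∪ ⁅ f ⁆) D) A B′)
      stable-B′ = stable A B′ B′⊆ nonempty′
      same-margin : margin (pd E (D ⊕ u)) A B ≡ margin (pd (E ∪ ⁅ f ⁆) D) A B′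
      same-margin = cong₂ (λ t c → t - twoμV Γ A + c)
        (twoDV-specialise {E} {D} {f} {u} A {B} (∉⇒lookup≡outside f∉B)) (δ-specialise f∉E f-u A B)

  moved : Subset M → Subset M → (Fin M → Fin N) → Fin N → ℤ
  moved E E′ φ v = Σℤ M (λ e → ι (lookup E e ∧ not (lookup E′ e) ∧ does (φ e ≟ v)))

  moved-self : ∀ E φ v → moved E E φ v ≡ 0ℤ
  moved-self E φ v = trans (Σℤ-cong M (λ e → cong ι (∧-not-self (lookup E e) _))) (Σℤ-zero M)

  moved-drop : ∀ E E′ F {i} φ v → lookup E i ≡ inside → lookup E′ i ≡ outside →
    lookup F i ≡ outside → (∀ j → j ≢ i → lookup F j ≡ lookup E j) →
    moved E E′ φ v ≡ moved F E′ φ v + ι (does (φ i ≟ v))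
  moved-drop E E′ F {i} φ v Ei E′i Fi F≗E = Σℤ-update M i other at-i
    where
    other : ∀ j → j ≢ i → ι (lookup E j ∧ not (lookup E′ j) ∧ does (φ j ≟ v))
                        ≡ ι (lookup F j ∧ not (lookup E′ j) ∧ does (φ j ≟ v))
    other j j≢i = cong (λ s → ι (s ∧ not (lookup E′ j) ∧ does (φ j ≟ v))) (sym (F≗E j j≢i))
    at-i : ι (lookup E i ∧ not (lookup E′ i) ∧ does (φ i ≟ v))
         ≡ ι (lookup F i ∧ not (lookup E′ i) ∧ does (φ i ≟ v)) + ι (does (φ i ≟ v))
    at-i rewrite Ei | E′i | Fi = sym (ℤ.+-identityˡ _)

  ≽-⊆⇒≡ : ∀ {x y} → _≽_ Γ x y → ℰ x ⊆ ℰ y → x ≡ y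
  ≽-⊆⇒≡ {pd Ex Dx} {pd Ey Dy} (Ey⊆Ex , φ , _ , Dy≡) Ex⊆Ey with ⊆-antisym Ex⊆Ey Ey⊆Ex
  ... | refl = cong (pd Ex) (lookup-ext λ v → sym (begin
    lookup Dy v                   ≡⟨ Dy≡ v ⟩
    lookup Dx v + moved Ex Ex φ v ≡⟨ cong (lookup Dx v +_) (moved-self Ex φ v) ⟩
    lookup Dx v + 0ℤ              ≡⟨ ℤ.+-identityʳ _ ⟩
    lookup Dx v                   ∎))
    where open ≡-Reasoning

  addV-≽-plusAt : ∀ {z f u} → f ∉ ℰ z → IsEnd Γ f u → _≽_ Γ (addV Γ z f) (plusAt Γ z u)
  addV-≽-plusAt {pd E D} {f} {u} f∉E f-u = p⊆p∪q ⁅ f ⁆ , (λ _ → u) , end , D⊕u≡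
    where
    end : ∀ e → e ∈ E ∪ ⁅ f ⁆ → e ∉ E → IsEnd Γ e u
    end e e∈ e∉E = subst (λ e → IsEnd Γ e u) (sym (∈-∪⁅⁆⁻ e∈ e∉E)) f-u
    D⊕u≡ : ∀ v → lookup (D ⊕ u) v ≡ lookup D v + moved (E ∪ ⁅ f ⁆) E (λ _ → u) v
    D⊕u≡ v = begin
      lookup (D ⊕ u) v                                         ≡⟨ lookup-⊕ D u v ⟩
      lookup D v + ι (does (u ≟ v))                            ≡⟨ cong (lookup D v +_) (ℤ.+-identityˡ _) ⟨
      lookup D v + (0ℤ + ι (does (u ≟ v)))                     ≡⟨ cong (λ s → lookup D v + (s + _)) (moved-self E (λ _ → u) v) ⟨
      lookup D v + (moved E E (λ _ → u) v + ι (does (u ≟ v)))  ≡⟨ cong (lookup D v +_) (moved-drop (E ∪ ⁅ f ⁆) E E (λ _ → u) v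
                                                                    (lookup-∪⁅⁆-self E f) (∉⇒lookup≡outside f∉E)
                                                                    (∉⇒lookup≡outside f∉E) (λ j j≢f → sym (lookup-∪⁅⁆-other E j≢f))) ⟨
      lookup D v + moved (E ∪ ⁅ f ⁆) E (λ _ → u) v             ∎
      where open ≡-Reasoning

  ≽-through-dropped : ∀ {Ex Dx Ey Dy i} (x≽y : _≽_ Γ (pd Ex Dx) (pd Ey Dy)) → i ∈ Ex → i ∉ Ey →
    _≽_ Γ (plusAt Γ (pd (Ex [ i ]≔ outside) Dx) (proj₁ (proj₂ x≽y) i)) (pd Ey Dy)
  ≽-through-dropped {Ex} {Dx} {Ey} {Dy} {i} (Ey⊆Ex , φ , end , Dy≡) i∈Ex i∉Ey =
    Ey⊆Ex-i , φ , (λ e e∈ → end e (∈-[]≔outside⁻ e∈)) , Dy≡′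
    where
    Ex-i : Subset M
    Ex-i = Ex [ i ]≔ outside
    Ey⊆Ex-i : Ey ⊆ Ex-i
    Ey⊆Ex-i {j} j∈Ey = ∈-[]≔-other⁺ (λ { refl → i∉Ey j∈Ey }) (Ey⊆Ex j∈Ey)
    Dy≡′ : ∀ v → lookup Dy v ≡ lookup (Dx ⊕ φ i) v + moved Ex-i Ey φ v
    Dy≡′ v = begin
      lookup Dy v                                            ≡⟨ Dy≡ v ⟩
      lookup Dx v + moved Ex Ey φ v                          ≡⟨ cong (lookup Dx v +_) (moved-drop Ex Ey Ex-i φ v
                                                                  ([]=⇒lookup i∈Ex) (∉⇒lookup≡outside i∉Ey)
                                                                  (lookup∘update i Ex outside) (λ j j≢i → lookup∘update′ j≢i Ex outside)) ⟩
      lookup Dx v + (moved Ex-i Ey φ v + ι (does (φ i ≟ v))) ≡⟨ swap (lookup Dx v) _ _ ⟩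
      (lookup Dx v + ι (does (φ i ≟ v))) + moved Ex-i Ey φ v ≡⟨ cong (_+ moved Ex-i Ey φ v) (lookup-⊕ Dx (φ i) v) ⟨
      lookup (Dx ⊕ φ i) v + moved Ex-i Ey φ v                ∎
      where
      open ≡-Reasoning
      swap : ∀ x y z → x + (y + z) ≡ (x + z) + y
      swap = solve-∀

  record Elementary (x y : PDiv Γ) : Set where
    constructor elementary
    field
      edge     : Fin M
      end      : Fin N
      edge-end : IsEnd Γ edge end
      edge∉    : edge ∉ ℰ y
      ℰ-eq     : ℰ x ≡ ℰ y ∪ ⁅ edge ⁆
      D-eq     : D y ≡ D x ⊕ end

  covers⇒elementary : ∀ {v₀ x y} → QuasiStable Γ v₀ x → CoversQD Γ v₀ x y → Elementary x y
  covers⇒elementary {v₀} {pd Ex Dx} {pd Ey Dy} x-stable ((x≽y , x≢y) , nothing-between)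
    with any? (λ i → i ∈? Ex ×-dec ¬? (i ∈? Ey))
  ... | no nothing-dropped = ⊥-elim (x≢y (≽-⊆⇒≡ x≽y Ex⊆Ey))
    where
    Ex⊆Ey : Ex ⊆ Ey
    Ex⊆Ey {j} j∈Ex with j ∈? Ey
    ... | yes j∈Ey = j∈Ey
    ... | no j∉Ey  = ⊥-elim (nothing-dropped (j , j∈Ex , j∉Ey))
  ... | yes (i , i∈Ex , i∉Ey) = elementary i (φ i) i-φi i∉Ey ℰ-eq (cong D y≡z)
    where
    φ : Fin M → Fin N
    φ = proj₁ (proj₂ x≽y)
    i-φi : IsEnd Γ i (φ i)
    i-φi = proj₁ (proj₂ (proj₂ x≽y)) i i∈Ex i∉Ey
    base z : PDiv Γ
    base = pd (Ex [ i ]≔ outside) Dx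
    z    = plusAt Γ base (φ i)
    x≡base+i : pd Ex Dx ≡ addV Γ base i
    x≡base+i = cong (λ E → pd E Dx) (sym ([]≔outside-∪⁅⁆ i∈Ex))
    z-stable : QuasiStable Γ v₀ z
    z-stable = quasiStable-specialise {v₀} {base} (∉-[]≔outside Ex i) i-φi (subst (QuasiStable Γ v₀) x≡base+i x-stable)
    x≻z : _≻_ Γ (pd Ex Dx) z
    x≻z = subst (λ x → _≽_ Γ x z) (sym x≡base+i) (addV-≽-plusAt {base} (∉-[]≔outside Ex i) i-φi) ,
          λ x≡z → ∉-[]≔outside Ex i (subst (i ∈_) (cong ℰ x≡z) i∈Ex)
    z≽y : _≽_ Γ z (pd Ey Dy)
    z≽y = ≽-through-dropped {Ex} {Dx} {Ey} {Dy} x≽y i∈Ex i∉Ey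
    only-i : ∀ {j} → j ∈ Ex → j ∉ Ey → j ≡ i
    only-i {j} j∈Ex j∉Ey with j ≟ i
    ... | yes j≡i = j≡i
    ... | no j≢i  = ⊥-elim (nothing-between (z , z-stable , x≻z , z≽y , z≢y))
      where
      z≢y : z ≢ pd Ey Dy
      z≢y z≡y = j∉Ey (subst (j ∈_) (cong ℰ z≡y) (∈-[]≔-other⁺ j≢i j∈Ex))
    y≡z : pd Ey Dy ≡ z
    y≡z = sym (≽-⊆⇒≡ z≽y ([]≔outside-⊆ only-i))
    ℰ-eq : Ex ≡ Ey ∪ ⁅ i ⁆
    ℰ-eq = trans (sym ([]≔outside-∪⁅⁆ i∈Ex)) (cong (_∪ ⁅ i ⁆) (sym (cong ℰ y≡z)))

  ShapeI ShapeII : PDiv Γ → Fin M → Fin M → Fin N → Fin N → PDiv Γ → PDiv Γ → PDiv Γ → PDiv Γ → Set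
  ShapeI x e₁ e₂ s t a b c d =
    a ≡ addV Γ x e₁ × b ≡ addV Γ x e₂ × c ≡ plusAt Γ x s × d ≡ plusAt Γ x t
  ShapeII x e₁ e₂ s t a b c d =
    a ≡ addV Γ (addV Γ (minusAt Γ x s) e₁) e₂ × b ≡ addV Γ (addV Γ (minusAt Γ x t) e₁) e₂ ×
    c ≡ addV Γ x e₂ × d ≡ addV Γ x e₁

  Diamond : PDiv Γ → PDiv Γ → PDiv Γ → PDiv Γ → Set
  Diamond a b c d =
    Σ (Fin M) λ e₁ → Σ (Fin M) λ e₂ → Σ (Fin N) λ s → Σ (Fin N) λ t → Σ (PDiv Γ) λ x →
      Parallel Γ e₁ e₂ s t × e₁ ∉ ℰ x × e₂ ∉ ℰ x ×
      (ShapeI x e₁ e₂ s t a b c d ⊎ ShapeII x e₁ e₂ s t a b c d)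

  module _ {a b c d : PDiv Γ} (a≢b : a ≢ b) where

    diamond-sameEdge : c ≢ d → (ac : Elementary a c) (ad : Elementary a d) → Elementary b c → Elementary b d →
      Elementary.edge ac ≡ Elementary.edge ad → Diamond a b c d
    diamond-sameEdge c≢d (elementary e u₁ e-u₁ e∉c a≡c+e Dc≡Da+u₁) (elementary _ u₂ e-u₂ e∉d a≡d+e Dd≡Da+u₂)
                         (elementary e₃ u₃ e₃-u₃ e₃∉c b≡c+e₃ Dc≡Db+u₃) (elementary e₄ u₄ e₄-u₄ _ b≡d+e₄ Dd≡Db+u₄) refl =
      e , e₃ , u₁ , u₂ , pd (ℰ c) (D a) ,
      (e≢e₃ , u₁≢u₂ , e-u₁ , e-u₂ , subst (IsEnd Γ e₃) (sym u₁≡u₃) e₃-u₃ ,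
       subst₂ (IsEnd Γ) (sym e₃≡e₄) (sym u₂≡u₄) e₄-u₄) ,
      e∉c , e₃∉c ,
      inj₁ (cong (λ E → pd E (D a)) a≡c+e , cong₂ pd b≡c+e₃ (sym Da≡Db) ,
            cong (pd (ℰ c)) Dc≡Da+u₁ , cong₂ pd (sym ℰc≡ℰd) Dd≡Da+u₂)
      where
      ℰc≡ℰd : ℰ c ≡ ℰ d
      ℰc≡ℰd = ∪⁅⁆-cancel e∉c e∉d (trans (sym a≡c+e) a≡d+e)
      u₁≢u₂ : u₁ ≢ u₂
      u₁≢u₂ refl = c≢d (cong₂ pd ℰc≡ℰd (trans Dc≡Da+u₁ (sym Dd≡Da+u₂)))
      rows : u₁ ≡ u₃ × u₂ ≡ u₄ × D a ≡ D b
      rows = ⊕-square-rows (trans (sym Dc≡Da+u₁) Dc≡Db+u₃) (trans (sym Dd≡Da+u₂) Dd≡Db+u₄) u₁≢u₂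
      u₁≡u₃ : u₁ ≡ u₃
      u₁≡u₃ = proj₁ rows
      u₂≡u₄ : u₂ ≡ u₄
      u₂≡u₄ = proj₁ (proj₂ rows)
      Da≡Db : D a ≡ D b
      Da≡Db = proj₂ (proj₂ rows)
      e≢e₃ : e ≢ e₃
      e≢e₃ refl = a≢b (cong₂ pd (trans a≡c+e (sym b≡c+e₃)) Da≡Db)
      e₃≡e₄ : e₃ ≡ e₄
      e₃≡e₄ = ∪⁅⁆-∉⇒≡ (subst (e₃ ∉_) ℰc≡ℰd e₃∉c) (trans (sym b≡c+e₃) b≡d+e₄)

    diamond-distinctEdges : (ac : Elementary a c) (ad : Elementary a d) → Elementary b c → Elementary b d →
      Elementary.edge ac ≢ Elementary.edge ad → Diamond a b c d
    diamond-distinctEdges (elementary e₁ u₁ e₁-u₁ e₁∉c a≡c+e₁ Dc≡Da+u₁) (elementary e₂ u₂ e₂-u₂ e₂∉d a≡d+e₂ Dd≡Da+u₂)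
                          (elementary e₃ u₃ e₃-u₃ _ b≡c+e₃ Dc≡Db+u₃) (elementary e₄ u₄ e₄-u₄ _ b≡d+e₄ Dd≡Db+u₄) e₁≢e₂ =
      e₁ , e₂ , u₁ , u₃ , pd r (D c) ,
      (e₁≢e₂ , u₁≢u₃ , e₁-u₁ , subst (λ e → IsEnd Γ e u₃) (sym e₁≡e₃) e₃-u₃ ,
       subst (IsEnd Γ e₂) (sym u₁≡u₂) e₂-u₂ , subst₂ (IsEnd Γ) (sym e₂≡e₄) (sym u₃≡u₄) e₄-u₄) ,
      e₁∉c ∘ ∈-[]≔outside⁻ , ∉-[]≔outside (ℰ c) e₂ ,
      inj₂ (cong₂ pd (trans a≡d+e₂ (cong (_∪ ⁅ e₂ ⁆) ℰd≡r+e₁)) (Da≡Dc-u (D a) u₁ Dc≡Da+u₁) ,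
            cong₂ pd (trans b≡d+e₄ (cong₂ (λ E e → E ∪ ⁅ e ⁆) ℰd≡r+e₁ (sym e₂≡e₄))) (Da≡Dc-u (D b) u₃ Dc≡Db+u₃) ,
            cong (λ E → pd E (D c)) ℰc≡r+e₂ ,
            cong₂ pd ℰd≡r+e₁ (trans Dd≡Da+u₂ (trans (cong (D a ⊕_) (sym u₁≡u₂)) (sym Dc≡Da+u₁))))
      where
      r : Subset M
      r = ℰ c [ e₂ ]≔ outside
      e₁∈d : e₁ ∈ ℰ d
      e₁∈d = ∪⁅⁆-≢⇒∈ e₁≢e₂ (trans (sym a≡c+e₁) a≡d+e₂)
      e₂∈c : e₂ ∈ ℰ c
      e₂∈c = ∪⁅⁆-≢⇒∈ (e₁≢e₂ ∘ sym) (trans (sym a≡d+e₂) a≡c+e₁)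
      e₁≡e₃ : e₁ ≡ e₃
      e₁≡e₃ = ∈-∪⁅⁆⁻ (subst (e₁ ∈_) (trans (sym b≡d+e₄) b≡c+e₃) (p⊆p∪q ⁅ e₄ ⁆ e₁∈d)) e₁∉c
      e₂≡e₄ : e₂ ≡ e₄
      e₂≡e₄ = ∈-∪⁅⁆⁻ (subst (e₂ ∈_) (trans (sym b≡c+e₃) b≡d+e₄) (p⊆p∪q ⁅ e₃ ⁆ e₂∈c)) e₂∉d
      u₁≢u₃ : u₁ ≢ u₃
      u₁≢u₃ refl = a≢b (cong₂ pd (trans a≡c+e₁ (trans (cong (λ e → ℰ c ∪ ⁅ e ⁆) e₁≡e₃) (sym b≡c+e₃)))
                                 (⊕-cancelʳ (trans (sym Dc≡Da+u₁) Dc≡Db+u₃)))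
      columns : u₁ ≡ u₂ × u₃ ≡ u₄
      columns = ⊕-square-columns (trans (sym Dc≡Da+u₁) Dc≡Db+u₃) (trans (sym Dd≡Da+u₂) Dd≡Db+u₄) u₁≢u₃
      u₁≡u₂ : u₁ ≡ u₂
      u₁≡u₂ = proj₁ columns
      u₃≡u₄ : u₃ ≡ u₄
      u₃≡u₄ = proj₂ columns
      ℰc≡r+e₂ : ℰ c ≡ r ∪ ⁅ e₂ ⁆
      ℰc≡r+e₂ = sym ([]≔outside-∪⁅⁆ e₂∈c)
      ℰd≡r+e₁ : ℰ d ≡ r ∪ ⁅ e₁ ⁆
      ℰd≡r+e₁ = ∪⁅⁆-cancel e₂∉d (λ e₂∈ → e₁≢e₂ (sym (∈-∪⁅⁆⁻ e₂∈ (∉-[]≔outside (ℰ c) e₂)))) (begin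
        ℰ d ∪ ⁅ e₂ ⁆          ≡⟨ a≡d+e₂ ⟨
        ℰ a                   ≡⟨ a≡c+e₁ ⟩
        ℰ c ∪ ⁅ e₁ ⁆          ≡⟨ cong (_∪ ⁅ e₁ ⁆) ℰc≡r+e₂ ⟩
        (r ∪ ⁅ e₂ ⁆) ∪ ⁅ e₁ ⁆ ≡⟨ ∪⁅⁆-swap r e₂ e₁ ⟩
        (r ∪ ⁅ e₁ ⁆) ∪ ⁅ e₂ ⁆ ∎)
        where open ≡-Reasoning
      Da≡Dc-u : ∀ Dx u → D c ≡ Dx ⊕ u → Dx ≡ D c ⊖ u
      Da≡Dc-u Dx u Dc≡ = trans (sym (⊖-⊕ Dx u)) (cong (_⊖ u) (sym Dc≡))

    diamond : c ≢ d → Elementary a c → Elementary a d → Elementary b c → Elementary b d → Diamond a b c d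
    diamond c≢d ac ad bc bd with Elementary.edge ac ≟ Elementary.edge ad
    ... | yes same    = diamond-sameEdge c≢d ac ad bc bd same
    ... | no distinct = diamond-distinctEdges ac ad bc bd distinct

<P⇒CoversP : ∀ {p q} → q <P p → CoversP p q
<P⇒CoversP q<p = q<p , λ { (_ , γ<α , ()) ; (_ , γ<β , ()) ; (_ , δ<α , ()) ; (_ , δ<β , ()) }

<P⇒elementary : ∀ Γ {v₀} (g : P → PDiv Γ) → (∀ p → QuasiStable Γ v₀ (g p)) →
  (∀ p q → CoversP p q → CoversQD Γ v₀ (g p) (g q)) → ∀ {p q} → q <P p → Elementary Γ (g p) (g q)
<P⇒elementary Γ g stable covers {p} {q} q<p = covers⇒elementary Γ (stable p) (covers p q (<P⇒CoversP q<p))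

image-of-enumeration : ∀ {X : Set} (g : P → X) {ps : List P} {ys : List X} →
  (∀ p → p ∈ₗ ps) → Pointwise (λ p y → g p ≡ y) ps ys → ImageIs g ys
image-of-enumeration g {ps} complete g[ps]≡ys =
  subst (ImageIs g) (map-≡ g[ps]≡ys) ((λ p → ∈-map⁺ g (complete p)) , preimage)
  where
  map-≡ : ∀ {ps ys} → Pointwise (λ p y → g p ≡ y) ps ys → List.map g ps ≡ ys
  map-≡ []         = refl
  map-≡ (g≡ ∷ g≡s) = cong₂ _∷_ g≡ (map-≡ g≡s)
  preimage : ∀ y → y ∈ₗ List.map g ps → Σ P λ p → g p ≡ y
  preimage y y∈ with ∈-map⁻ g y∈
  ... | p , _ , y≡gp = p , sym y≡gp

αβγδ-complete : ∀ p → p ∈ₗ α ∷ β ∷ γ ∷ δP ∷ []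
αβγδ-complete α  = here refl
αβγδ-complete β  = there (here refl)
αβγδ-complete γ  = there (there (here refl))
αβγδ-complete δP = there (there (there (here refl)))

βαδγ-complete : ∀ p → p ∈ₗ β ∷ α ∷ δP ∷ γ ∷ []
βαδγ-complete α  = there (here refl)
βαδγ-complete β  = here refl
βαδγ-complete γ  = there (there (there (here refl)))
βαδγ-complete δP = there (there (here refl))

proposition4p2 : (Γ : Graph) → Connected Γ → (v₀ : Fin (n Γ)) →
    (g : P → PDiv Γ) →
    (∀ p → QuasiStable Γ v₀ (g p)) →
    (∀ p q → p ≤P q → _≽_ Γ (g q) (g p)) →
    (∀ p q → g p ≡ g q → p ≡ q) →
    (∀ p q → CoversP p q → CoversQD Γ v₀ (g p) (g q)) →
    Σ (Fin (m Γ)) λ e₁ → Σ (Fin (m Γ)) λ e₂ → Σ (Fin (n Γ)) λ s → Σ (Fin (n Γ)) λ t →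
    Σ (Subset (m Γ)) λ ℰ →
      Parallel Γ e₁ e₂ s t × e₁ ∉ ℰ × e₂ ∉ ℰ ×
      ((Σ (PDiv Γ) λ x → PDiv.ℰ x ≡ ℰ ×
          ImageIs g (addV Γ x e₁ ∷ addV Γ x e₂ ∷ plusAt Γ x s ∷ plusAt Γ x t ∷ []))
       ⊎
       (Σ (PDiv Γ) λ x → PDiv.ℰ x ≡ ℰ ×
          ImageIs g (addV Γ (addV Γ (minusAt Γ x t) e₁) e₂
                   ∷ addV Γ (addV Γ (minusAt Γ x s) e₁) e₂
                   ∷ addV Γ x e₁ ∷ addV Γ x e₂ ∷ [])))
proposition4p2 Γ _ _ g stable _ injective covers
  with diamond Γ ((λ ()) ∘ injective α β) ((λ ()) ∘ injective γ δP)
         (<P⇒elementary Γ g stable covers γ<α) (<P⇒elementary Γ g stable covers δ<α)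
         (<P⇒elementary Γ g stable covers γ<β) (<P⇒elementary Γ g stable covers δ<β)
... | e₁ , e₂ , s , t , x , parallel , e₁∉ , e₂∉ , inj₁ (gα≡ , gβ≡ , gγ≡ , gδ≡) =
  e₁ , e₂ , s , t , ℰ x , parallel , e₁∉ , e₂∉ ,
  inj₁ (x , refl , image-of-enumeration g αβγδ-complete (gα≡ ∷ gβ≡ ∷ gγ≡ ∷ gδ≡ ∷ []))
... | e₁ , e₂ , s , t , x , parallel , e₁∉ , e₂∉ , inj₂ (gα≡ , gβ≡ , gγ≡ , gδ≡) =
  e₁ , e₂ , s , t , ℰ x , parallel , e₁∉ , e₂∉ ,
  inj₂ (x , refl , image-of-enumeration g βαδγ-complete (gβ≡ ∷ gα≡ ∷ gδ≡ ∷ gγ≡ ∷ []))
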